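{- Let $n\ge4$ and $0<a<b<2a$. Suppose $\pi$ is a set partition of $[n]$ into $m$ parts such that each part has cardinality at least $2$. Then there is no matroid $\mathcal{E}$ on $[n]$ and weight vector $w\in\mathbb{R}^n_{\ge0}$ such that the partition valuation $v^{\pi,a,b}$ equals the weighted rank $\rho^w$ of $\mathcal{E}$.
   Context: $[n]=\{1,\dots,n\}$. The partition valuation $v^{\pi,a,b}:2^{[n]}\to\mathbb{R}_{\ge0}$ is given by $v(\emptyset)=0$, $v(I)=a$ if $\emptyset\ne I\subseteq\pi_r$ for some part $\pi_r$ of $\pi$, and $v(I)=b$ otherwise. For a matroid on $[n]$ with independent sets $\mathcal{I}$ and $w\in\mathbb{R}^n_{\ge0}$, the weighted rank is $\rho^w(T)=\max\{\sum_{i\in I}w_i:I\in\mathcal{I},I\subseteq T\}$. -}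

module Defs where

open import Level using (0ℓ)
open import Data.Nat using (ℕ; zero; suc) renaming (_<_ to _<ℕ_)
open import Data.Fin using (Fin; zero; suc) renaming (_≟_ to _≟ᶠ_)
open import Data.Fin.Subset using (Subset; Side; inside; outside; _∈_; _∉_; _⊆_; _∪_; ⁅_⁆; ∣_∣; Nonempty)
open import Data.Fin.Subset.Properties using (_⊆?_; nonempty?)
open import Data.Fin.Properties using (any?)
open import Data.Vec using (Vec; []; _∷_; tabulate)
open import Data.Product using (Σ; ∃; _×_; _,_)
open import Data.Sum using (_⊎_)
open import Relation.Nullary using (¬_; yes; no)
open import Relation.Binary using (Rel; IsStrictTotalOrder)
open import Algebra.Structures using (IsCommutativeRing)

-- An ordered field (ℝ is an instance).  The weights and the constants
-- a, b of the paper live in an arbitrary ordered field.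

record OrderedField : Set₁ where
  infix  4 _≈_ _<_ _≤_
  infixl 6 _+_
  infixl 7 _*_
  field
    Carrier : Set
    _≈_     : Rel Carrier 0ℓ
    _+_     : Carrier → Carrier → Carrier
    _*_     : Carrier → Carrier → Carrier
    -_      : Carrier → Carrier
    0#      : Carrier
    1#      : Carrier
    _<_     : Rel Carrier 0ℓ
    isCommutativeRing  : IsCommutativeRing _≈_ _+_ _*_ -_ 0# 1#
    isStrictTotalOrder : IsStrictTotalOrder _≈_ _<_
    +-monoˡ-< : ∀ {x y} z → x < y → x + z < y + z
    *-pos     : ∀ {x y} → 0# < x → 0# < y → 0# < x * y
    inverse   : ∀ x → ¬ (x ≈ 0#) → ∃ λ y → x * y ≈ 1#

  _≤_ : Rel Carrier 0ℓ
  x ≤ y = x < y ⊎ x ≈ y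

record Matroid (n : ℕ) : Set₁ where
  field
    Indep        : Subset n → Set
    indep-empty  : Indep (Data.Fin.Subset.⊥)
    indep-hered  : ∀ {I J} → I ⊆ J → Indep J → Indep I
    indep-augment : ∀ {I J} → Indep I → Indep J → ∣ I ∣ <ℕ ∣ J ∣ →
                    ∃ λ x → x ∈ J × x ∉ I × Indep (I ∪ ⁅ x ⁆)

module _ (F : OrderedField) where
  open OrderedField F

  wsum : ∀ {n} → (Fin n → Carrier) → Subset n → Carrier
  wsum w []            = 0#
  wsum w (inside  ∷ I) = w zero + wsum (λ i → w (suc i)) I
  wsum w (outside ∷ I) = wsum (λ i → w (suc i)) I

  IsWeightedRank : ∀ {n} → Matroid n → (Fin n → Carrier) → Subset n → Carrier → Set
  IsWeightedRank M w T x =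
    (∃ λ I → Matroid.Indep M I × I ⊆ T × wsum w I ≈ x) ×
    (∀ I → Matroid.Indep M I → I ⊆ T → wsum w I ≤ x)

  -- partition valuation v^{π,a,b}; π : Fin n → Fin m assigns each element its part
  partOf : ∀ {n m} → (Fin n → Fin m) → Fin m → Subset n
  partOf π r = tabulate λ i → decide (π i ≟ᶠ r)
    where
    decide : ∀ {A : Set} → Relation.Nullary.Dec A → Side
    decide (yes _) = inside
    decide (no _)  = outside

  partitionValuation : ∀ {n m} → (Fin n → Fin m) → Carrier → Carrier → Subset n → Carrier
  partitionValuation π a b I with nonempty? I
  ... | no _  = 0#
  ... | yes _ with any? (λ r → I ⊆? partOf π r)
  ...   | yes _ = a
  ...   | no _  = b

-- Only the first half of the weighted-rank condition (the rank of T is attained by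
-- some subset of T) is needed.  On a singleton {j} that subset is ∅ or {j}, and
-- v({j}) = a > 0 forces w_j = a.  Picking i and k in different parts, the rank of
-- {i, k} is then one of 0, a, a + a, while v({i, k}) = b lies strictly between a
-- and a + a.
module Submission where

open import Defs
open import Data.Nat using (ℕ) renaming (_≤_ to _≤ℕ_)
open import Data.Fin using (Fin)
open import Data.Fin.Subset using (Subset; ∣_∣)
open import Data.Product using (Σ; _×_)
open import Relation.Nullary using (¬_)

open import Data.Nat using (zero; suc; s≤s) renaming (_<_ to _<ℕ_)
open import Data.Nat.Properties using (<⇒≤)
open import Data.Fin using (zero; suc) renaming (_≟_ to _≟ᶠ_)
open import Data.Fin.Subset using (⊥; ⁅_⁆; _∪_; _∈_; _∉_; _⊆_; Nonempty; inside; outside)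
open import Data.Fin.Subset.Properties
  using (_∈?_; _⊆?_; nonempty?; ⊆-antisym; Empty-unique; x∈⁅x⁆; x∈⁅y⁆⇒x≡y;
         x∈p∪q⁻; x∈p∪q⁺; ∪-identityˡ; ∪-identityʳ)
open import Data.Fin.Properties using (any?)
open import Data.Vec using (_∷_; lookup; here; there)
open import Data.Vec.Properties using ([]=⇒lookup; lookup⇒[]=; lookup∘tabulate)
open import Data.Product using (∃₂; _,_)
open import Data.Sum using (inj₁; inj₂; _⊎_)
open import Relation.Binary.PropositionalEquality using (_≡_; _≢_; refl; sym; trans; cong; subst)
open import Relation.Nullary using (yes; no; contradiction)
open import Relation.Binary using (IsStrictTotalOrder)
open import Algebra.Structures using (IsCommutativeRing)

private
  variable
    n : ℕ
    p q r : Subset n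

0<∣p∣⇒Nonempty : 0 <ℕ ∣ p ∣ → Nonempty p
0<∣p∣⇒Nonempty {p = inside ∷ p}  _     = zero , here
0<∣p∣⇒Nonempty {p = outside ∷ p} 0<∣p∣ with 0<∣p∣⇒Nonempty {p = p} 0<∣p∣
... | x , x∈p = suc x , there x∈p

x∈p⇒⁅x⁆⊆p : ∀ {x} → x ∈ p → ⁅ x ⁆ ⊆ p
x∈p⇒⁅x⁆⊆p {p = p} {x} x∈p y∈⁅x⁆ = subst (_∈ p) (sym (x∈⁅y⁆⇒x≡y x y∈⁅x⁆)) x∈p

p⊆r∧q⊆r⇒p∪q⊆r : p ⊆ r → q ⊆ r → p ∪ q ⊆ r
p⊆r∧q⊆r⇒p∪q⊆r {p = p} {q = q} p⊆r q⊆r y∈p∪q with x∈p∪q⁻ p q y∈p∪q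
... | inj₁ y∈p = p⊆r y∈p
... | inj₂ y∈q = q⊆r y∈q

p⊆⁅x⁆∧x∉p⇒p≡⊥ : ∀ {x} → p ⊆ ⁅ x ⁆ → x ∉ p → p ≡ ⊥
p⊆⁅x⁆∧x∉p⇒p≡⊥ {p = p} {x} p⊆⁅x⁆ x∉p =
  Empty-unique λ (y , y∈p) → x∉p (subst (_∈ p) (x∈⁅y⁆⇒x≡y x (p⊆⁅x⁆ y∈p)) y∈p)

p⊆q∪⁅x⁆∧x∉p⇒p⊆q : ∀ {x} → p ⊆ q ∪ ⁅ x ⁆ → x ∉ p → p ⊆ q
p⊆q∪⁅x⁆∧x∉p⇒p⊆q {p = p} {q = q} {x} p⊆q∪⁅x⁆ x∉p {y} y∈p with x∈p∪q⁻ q ⁅ x ⁆ (p⊆q∪⁅x⁆ y∈p)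
... | inj₁ y∈q   = y∈q
... | inj₂ y∈⁅x⁆ = contradiction (subst (_∈ p) (x∈⁅y⁆⇒x≡y x y∈⁅x⁆) y∈p) x∉p

p⊆⁅x⁆∪q∧x∉p⇒p⊆q : ∀ {x} → p ⊆ ⁅ x ⁆ ∪ q → x ∉ p → p ⊆ q
p⊆⁅x⁆∪q∧x∉p⇒p⊆q {p = p} {q = q} {x} p⊆⁅x⁆∪q x∉p {y} y∈p with x∈p∪q⁻ ⁅ x ⁆ q (p⊆⁅x⁆∪q y∈p)
... | inj₁ y∈⁅x⁆ = contradiction (subst (_∈ p) (x∈⁅y⁆⇒x≡y x y∈⁅x⁆) y∈p) x∉p
... | inj₂ y∈q   = y∈q

⊆⁅⁆-cases : ∀ x → p ⊆ ⁅ x ⁆ → p ≡ ⊥ ⊎ p ≡ ⁅ x ⁆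
⊆⁅⁆-cases {p = p} x p⊆⁅x⁆ with x ∈? p
... | yes x∈p = inj₂ (⊆-antisym p⊆⁅x⁆ (x∈p⇒⁅x⁆⊆p x∈p))
... | no  x∉p = inj₁ (p⊆⁅x⁆∧x∉p⇒p≡⊥ p⊆⁅x⁆ x∉p)

⊆⁅⁆∪⁅⁆-cases : ∀ x y → p ⊆ ⁅ x ⁆ ∪ ⁅ y ⁆ →
               p ≡ ⊥ ⊎ p ≡ ⁅ x ⁆ ⊎ p ≡ ⁅ y ⁆ ⊎ p ≡ ⁅ x ⁆ ∪ ⁅ y ⁆
⊆⁅⁆∪⁅⁆-cases {p = p} x y p⊆ with x ∈? p | y ∈? p
... | yes x∈p | yes y∈p =
  inj₂ (inj₂ (inj₂ (⊆-antisym p⊆ (p⊆r∧q⊆r⇒p∪q⊆r (x∈p⇒⁅x⁆⊆p x∈p) (x∈p⇒⁅x⁆⊆p y∈p)))))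
... | yes x∈p | no  y∉p = inj₂ (inj₁ (⊆-antisym (p⊆q∪⁅x⁆∧x∉p⇒p⊆q p⊆ y∉p) (x∈p⇒⁅x⁆⊆p x∈p)))
... | no  x∉p | yes y∈p = inj₂ (inj₂ (inj₁ (⊆-antisym (p⊆⁅x⁆∪q∧x∉p⇒p⊆q p⊆ x∉p) (x∈p⇒⁅x⁆⊆p y∈p))))
... | no  x∉p | no  y∉p = inj₁ (p⊆⁅x⁆∧x∉p⇒p≡⊥ (p⊆q∪⁅x⁆∧x∉p⇒p⊆q p⊆ y∉p) x∉p)

module _ {n m : ℕ} (F : OrderedField) (π : Fin n → Fin m) where

  private
    lookup-partOf-outside : ∀ {x r} → lookup (partOf F π r) x ≡ outside → π x ≢ r
    lookup-partOf-outside {x} {r} eq with π x ≟ᶠ r | trans (sym (lookup∘tabulate _ x)) eq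
    ... | yes _     | ()
    ... | no  πx≢r | _ = πx≢r

  ∈-partOf⁻ : ∀ {x r} → x ∈ partOf F π r → π x ≡ r
  ∈-partOf⁻ {x} {r} x∈ with π x ≟ᶠ r | trans (sym (lookup∘tabulate _ x)) ([]=⇒lookup x∈)
  ... | yes πx≡r | _ = πx≡r
  ... | no  _     | ()

  ∈-partOf⁺ : ∀ {x r} → π x ≡ r → x ∈ partOf F π r
  ∈-partOf⁺ {x} {r} πx≡r = lookup⇒[]= x _ lookup≡inside
    where
    lookup≡inside : lookup (partOf F π r) x ≡ inside
    lookup≡inside with lookup (partOf F π r) x in eq
    ... | inside  = refl
    ... | outside = contradiction πx≡r (lookup-partOf-outside eq)

  module _ (a b : OrderedField.Carrier F) where

    partitionValuation-⊆partOf : ∀ {T r} → Nonempty T → T ⊆ partOf F π r →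
                                 partitionValuation F π a b T ≡ a
    partitionValuation-⊆partOf {T} {r} T≢∅ T⊆πr with nonempty? T
    ... | no T≡∅ = contradiction T≢∅ T≡∅
    ... | yes _ with any? (λ r → T ⊆? partOf F π r)
    ...   | yes _      = refl
    ...   | no  ¬∃part = contradiction (r , λ {x} → T⊆πr) ¬∃part

    partitionValuation-⊈partOf : ∀ {T} → Nonempty T → (∀ r → ¬ T ⊆ partOf F π r) →
                                 partitionValuation F π a b T ≡ b
    partitionValuation-⊈partOf {T} T≢∅ T⊈parts with nonempty? T
    ... | no T≡∅ = contradiction T≢∅ T≡∅
    ... | yes _ with any? (λ r → T ⊆? partOf F π r)
    ...   | yes (r , T⊆πr) = contradiction (λ {x} → T⊆πr) (T⊈parts r)
    ...   | no  _          = refl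

    partitionValuation-⁅⁆ : ∀ x → partitionValuation F π a b ⁅ x ⁆ ≡ a
    partitionValuation-⁅⁆ x =
      partitionValuation-⊆partOf (x , x∈⁅x⁆ x) λ y∈⁅x⁆ → ∈-partOf⁺ (cong π (x∈⁅y⁆⇒x≡y x y∈⁅x⁆))

    partitionValuation-⁅⁆∪⁅⁆ : ∀ x y → π x ≢ π y →
                              partitionValuation F π a b (⁅ x ⁆ ∪ ⁅ y ⁆) ≡ b
    partitionValuation-⁅⁆∪⁅⁆ x y πx≢πy =
      partitionValuation-⊈partOf (x , x∈⁅x⁆∪⁅y⁆) λ r ⊆πr →
        πx≢πy (trans (∈-partOf⁻ (⊆πr x∈⁅x⁆∪⁅y⁆)) (sym (∈-partOf⁻ (⊆πr y∈⁅x⁆∪⁅y⁆))))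
      where
      x∈⁅x⁆∪⁅y⁆ = x∈p∪q⁺ (inj₁ (x∈⁅x⁆ x))
      y∈⁅x⁆∪⁅y⁆ = x∈p∪q⁺ (inj₂ (x∈⁅x⁆ y))

  ∃-in-distinct-parts : 2 ≤ℕ m → (∀ r → 0 <ℕ ∣ partOf F π r ∣) → ∃₂ λ x y → π x ≢ π y
  ∃-in-distinct-parts (s≤s (s≤s _)) 0<∣πr∣
    with 0<∣p∣⇒Nonempty (0<∣πr∣ zero) | 0<∣p∣⇒Nonempty (0<∣πr∣ (suc zero))
  ... | x , x∈π₀ | y , y∈π₁ = x , y , λ πx≡πy →
    contradiction (trans (sym (∈-partOf⁻ x∈π₀)) (trans πx≡πy (∈-partOf⁻ y∈π₁))) λ ()

module _ (F : OrderedField) where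
  open OrderedField F
  private
    module R = IsCommutativeRing isCommutativeRing
    module O = IsStrictTotalOrder isStrictTotalOrder

  <⇒≉ : ∀ {x y} → x < y → ¬ x ≈ y
  <⇒≉ x<y x≈y = O.irrefl x≈y x<y

  wsum-⊥ : (w : Fin n → Carrier) → wsum F w ⊥ ≡ 0#
  wsum-⊥ {zero}  w = refl
  wsum-⊥ {suc n} w = wsum-⊥ (λ i → w (suc i))

  wsum-⁅⁆ : (w : Fin n → Carrier) (i : Fin n) → wsum F w ⁅ i ⁆ ≈ w i
  wsum-⁅⁆ w zero    = R.trans (R.+-cong R.refl (R.reflexive (wsum-⊥ (λ j → w (suc j))))) (R.+-identityʳ _)
  wsum-⁅⁆ w (suc i) = wsum-⁅⁆ (λ j → w (suc j)) i

  wsum-⁅⁆∪⁅⁆ : (w : Fin n → Carrier) {i k : Fin n} → i ≢ k → wsum F w (⁅ i ⁆ ∪ ⁅ k ⁆) ≈ w i + w k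
  wsum-⁅⁆∪⁅⁆ w {zero}  {zero}  i≢k = contradiction refl i≢k
  wsum-⁅⁆∪⁅⁆ w {zero}  {suc k} _ rewrite ∪-identityˡ ⁅ k ⁆ = R.+-cong R.refl (wsum-⁅⁆ _ k)
  wsum-⁅⁆∪⁅⁆ w {suc i} {zero}  _ rewrite ∪-identityʳ ⁅ i ⁆ =
    R.trans (R.+-cong R.refl (wsum-⁅⁆ _ i)) (R.+-comm _ _)
  wsum-⁅⁆∪⁅⁆ w {suc i} {suc k} i≢k = wsum-⁅⁆∪⁅⁆ (λ j → w (suc j)) (λ i≡k → i≢k (cong suc i≡k))

  module _ {n : ℕ} (M : Matroid n) {w : Fin n → Carrier} {x : Carrier} where

    weightedRank-⁅⁆ : ∀ {j} → ¬ x ≈ 0# → IsWeightedRank F M w ⁅ j ⁆ x → w j ≈ x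
    weightedRank-⁅⁆ {j} x≉0 ((I , _ , I⊆⁅j⁆ , wI≈x) , _) with ⊆⁅⁆-cases j I⊆⁅j⁆
    ... | inj₁ refl = contradiction (R.trans (R.sym wI≈x) (R.reflexive (wsum-⊥ w))) x≉0
    ... | inj₂ refl = R.trans (R.sym (wsum-⁅⁆ w j)) wI≈x

    weightedRank-⁅⁆∪⁅⁆ : ∀ {i k} → i ≢ k → IsWeightedRank F M w (⁅ i ⁆ ∪ ⁅ k ⁆) x →
                         x ≈ 0# ⊎ x ≈ w i ⊎ x ≈ w k ⊎ x ≈ w i + w k
    weightedRank-⁅⁆∪⁅⁆ {i} {k} i≢k ((I , _ , I⊆ , wI≈x) , _) with ⊆⁅⁆∪⁅⁆-cases i k I⊆
    ... | inj₁ refl                = inj₁ (R.trans (R.sym wI≈x) (R.reflexive (wsum-⊥ w)))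
    ... | inj₂ (inj₁ refl)         = inj₂ (inj₁ (R.trans (R.sym wI≈x) (wsum-⁅⁆ w i)))
    ... | inj₂ (inj₂ (inj₁ refl))  = inj₂ (inj₂ (inj₁ (R.trans (R.sym wI≈x) (wsum-⁅⁆ w k))))
    ... | inj₂ (inj₂ (inj₂ refl))  = inj₂ (inj₂ (inj₂ (R.trans (R.sym wI≈x) (wsum-⁅⁆∪⁅⁆ w i≢k))))

lemma3p5 : (F : OrderedField) → let open OrderedField F in
    (n m : ℕ) → 4 ≤ℕ n → 2 ≤ℕ m →
    (a b : Carrier) → 0# < a → a < b → b < a + a →
    (π : Fin n → Fin m) → (∀ r → 2 ≤ℕ ∣ partOf F π r ∣) →
    ¬ (Σ (Matroid n) λ M → Σ (Fin n → Carrier) λ w →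
    (∀ i → 0# ≤ w i) ×
    (∀ T → IsWeightedRank F M w T (partitionValuation F π a b T)))
lemma3p5 F n m _ 2≤m a b 0<a a<b b<a+a π 2≤∣πr∣ (M , w , _ , isRank) =
  noSeparatedPair (∃-in-distinct-parts F π 2≤m (λ r → <⇒≤ (2≤∣πr∣ r)))
  where
  open OrderedField F
  module R = IsCommutativeRing isCommutativeRing
  module O = IsStrictTotalOrder isStrictTotalOrder

  w≈a : ∀ j → w j ≈ a
  w≈a j = weightedRank-⁅⁆ F M (λ a≈0 → <⇒≉ F 0<a (R.sym a≈0))
            (subst (IsWeightedRank F M w ⁅ j ⁆) (partitionValuation-⁅⁆ F π a b j) (isRank ⁅ j ⁆))

  noSeparatedPair : ¬ ∃₂ λ i k → π i ≢ π k
  noSeparatedPair (i , k , πi≢πk)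
    with weightedRank-⁅⁆∪⁅⁆ F M (λ i≡k → πi≢πk (cong π i≡k))
           (subst (IsWeightedRank F M w (⁅ i ⁆ ∪ ⁅ k ⁆)) (partitionValuation-⁅⁆∪⁅⁆ F π a b i k πi≢πk)
                  (isRank (⁅ i ⁆ ∪ ⁅ k ⁆)))
  ... | inj₁ b≈0                 = <⇒≉ F (O.trans 0<a a<b) (R.sym b≈0)
  ... | inj₂ (inj₁ b≈wi)         = <⇒≉ F a<b (R.sym (R.trans b≈wi (w≈a i)))
  ... | inj₂ (inj₂ (inj₁ b≈wk))  = <⇒≉ F a<b (R.sym (R.trans b≈wk (w≈a k)))
  ... | inj₂ (inj₂ (inj₂ b≈2a))  = <⇒≉ F b<a+a (R.trans b≈2a (R.+-cong (w≈a i) (w≈a k)))
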